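{- Let $G$ be a graph and let $x$ be a vertex of $G$ fixed by every automorphism of $G$, such that $\chi_D(G)-1>\deg(x)$. Then $G$ is not uniquely distinguishing colorable.
   Context: A distinguishing $k$-coloring of a graph is a partition of its vertex set into exactly $k$ non-empty independent sets such that only the identity automorphism maps every class onto itself; $\chi_D$ is the least such $k$. A graph is uniquely distinguishing colorable if there is exactly one partition of its vertex set into $\chi_D$ classes forming a distinguishing coloring. -}

module Defs where

open import Data.Nat using (ℕ; _<_)
open import Data.Bool using (Bool; true; false)
open import Data.Fin using (Fin)
open import Data.List using (length; filterᵇ; allFin)
open import Data.Product using (Σ; _×_; _,_; proj₁)
open import Relation.Binary.PropositionalEquality using (_≡_; _≢_)
open import Relation.Nullary using (¬_)
open import Function.Bundles using (_⇔_)

record Graph (n : ℕ) : Set where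
  field
    adj     : Fin n → Fin n → Bool
    adj-sym : ∀ u v → adj u v ≡ adj v u
    irrefl  : ∀ v → adj v v ≡ false
open Graph public

deg : ∀ {n} → Graph n → Fin n → ℕ
deg {n} G x = length (filterᵇ (adj G x) (allFin n))

record Automorphism {n : ℕ} (G : Graph n) : Set where
  field
    to       : Fin n → Fin n
    from     : Fin n → Fin n
    to-from  : ∀ v → to (from v) ≡ v
    from-to  : ∀ v → from (to v) ≡ v
    preserve : ∀ u v → adj G (to u) (to v) ≡ adj G u v
open Automorphism public

record Coloring {n : ℕ} (G : Graph n) (k : ℕ) : Set where
  field
    col      : Fin n → Fin k
    proper   : ∀ u v → adj G u v ≡ true → col u ≢ col v
    nonempty : ∀ (i : Fin k) → Σ (Fin n) (λ v → col v ≡ i)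
open Coloring public

IsDistinguishing : ∀ {n k} {G : Graph n} → Coloring G k → Set
IsDistinguishing {n} {k} {G} c =
  (σ : Automorphism G) → (∀ v → col c (to σ v) ≡ col c v) → ∀ v → to σ v ≡ v

DistColoring : ∀ {n} → Graph n → ℕ → Set
DistColoring G k = Σ (Coloring G k) IsDistinguishing

IsChiD : ∀ {n} → Graph n → ℕ → Set
IsChiD G k = DistColoring G k × (∀ j → j < k → ¬ DistColoring G j)

SamePartition : ∀ {n k} {G : Graph n} → Coloring G k → Coloring G k → Set
SamePartition {n} c c' = ∀ (u v : Fin n) → (col c u ≡ col c v) ⇔ (col c' u ≡ col c' v)

UniquelyDistColorable : ∀ {n} → Graph n → Set
UniquelyDistColorable G =
  Σ ℕ λ k → IsChiD G k ×
    Σ (DistColoring G k) λ { (c , _) →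
      (d : DistColoring G k) → SamePartition c (proj₁ d) }

-- Let c be a distinguishing coloring with χ_D(G) colors. As x has fewer than
-- χ_D(G) - 1 neighbours, some color j is used neither at x nor at any
-- neighbour of x; recoloring x with j keeps the coloring proper, and it stays
-- distinguishing because every automorphism fixes x. If x shared its old color
-- with another vertex, this is a second distinguishing χ_D(G)-coloring with a
-- different partition; otherwise the old color of x disappears, leaving a
-- distinguishing coloring with χ_D(G) - 1 colors, contradicting minimality.
{-# OPTIONS --safe #-}
module Submission where

open import Defs
open import Data.Nat using (ℕ; suc; _<_; _+_)
open import Data.Nat.Properties using (+-comm; n<1+n; <-≤-trans; ≮⇒≥)
open import Data.Fin using (Fin; punchOut; punchIn; _≟_)
open import Data.Fin.Properties
  using (any?; ¬∀⟶∃¬; pigeonhole; <⇒≢; punchOut-cong; punchOut-injective; punchOut-punchIn; punchInᵢ≢i)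
open import Data.Vec.Functional using (updateAt)
open import Data.Vec.Functional.Properties using (updateAt-updates; updateAt-minimal)
open import Data.List using (List; _∷_; length; map; filterᵇ; allFin; lookup)
open import Data.List.Properties using (length-map)
open import Data.List.Membership.Propositional using (_∈_; _∉_)
open import Data.List.Membership.Propositional.Properties using (∈-map⁺; ∈-filter⁺; ∈-allFin)
import Data.List.Membership.DecPropositional as DecMembership
open import Data.List.Relation.Unary.Any using (here; there; index)
open import Data.List.Relation.Unary.Any.Properties using (lookup-index)
open import Data.Bool using (true; T)
open import Data.Bool.Properties using (T?)
open import Data.Product using (∃; _×_; _,_; proj₁; proj₂)
open import Relation.Binary.PropositionalEquality using (_≡_; _≢_; refl; sym; trans; cong; subst; subst₂)
open import Relation.Nullary using (¬_; yes; no; ¬?; contradiction)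
open import Relation.Nullary.Decidable using (_×-dec_)
open import Function using (_∘_; const)
open import Function.Bundles using (Equivalence)

length<⇒∃∉ : ∀ {k} (L : List (Fin k)) → length L < k → ∃ λ j → j ∉ L
length<⇒∃∉ {k} L |L|<k = ¬∀⟶∃¬ k (_∈ L) (_∈? L) covers⇒⊥
  where
  open DecMembership (_≟_ {k}) using (_∈?_)
  covers⇒⊥ : ¬ (∀ j → j ∈ L)
  covers⇒⊥ covers with pigeonhole |L|<k (λ j → index (covers j))
  ... | i , j , i<j , same-index =
    <⇒≢ i<j (trans (lookup-index (covers i))
                   (trans (cong (lookup L) same-index) (sym (lookup-index (covers j)))))

module _ {n : ℕ} {G : Graph n} where

  automorphism-fixing-≢ : (σ : Automorphism G) {x v : Fin n} → to σ x ≡ x → v ≢ x → to σ v ≢ x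
  automorphism-fixing-≢ σ {x} {v} σx≡x v≢x σv≡x =
    v≢x (trans (sym (from-to σ v)) (trans (cong (from σ) (trans σv≡x (sym σx≡x))) (from-to σ x)))

  adj⇒∈-neighbours : ∀ {x u} → adj G x u ≡ true → u ∈ filterᵇ (adj G x) (allFin n)
  adj⇒∈-neighbours {x} {u} xu = ∈-filter⁺ (T? ∘ adj G x) (∈-allFin u) (subst T (sym xu) _)

  ∃-color-unused-on-closed-neighbourhood : ∀ {k} (c : Coloring G k) (x : Fin n) → deg G x + 1 < k →
    ∃ λ j → j ≢ col c x × (∀ u → adj G x u ≡ true → col c u ≢ j)
  ∃-color-unused-on-closed-neighbourhood {k} c x deg+1<k =
    j , (j∉L ∘ here) ,
        (λ u xu cu≡j → j∉L (there (subst (_∈ map (col c) N) cu≡j (∈-map⁺ (col c) (adj⇒∈-neighbours xu)))))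
    where
    N = filterᵇ (adj G x) (allFin n)
    L = col c x ∷ map (col c) N
    |L|<k : length L < k
    |L|<k = subst (_< k) (trans (+-comm (deg G x) 1) (cong suc (sym (length-map (col c) N)))) deg+1<k
    j = proj₁ (length<⇒∃∉ L |L|<k)
    j∉L = proj₂ (length<⇒∃∉ L |L|<k)

module _ {n m : ℕ} (f : Fin n → Fin (suc m)) (i : Fin (suc m)) (i∉f : ∀ v → i ≢ f v) where

  squeeze : Fin n → Fin m
  squeeze v = punchOut (i∉f v)

  squeeze-reflects-≡ : ∀ {u v} → squeeze u ≡ squeeze v → f u ≡ f v
  squeeze-reflects-≡ {u} {v} = punchOut-injective (i∉f u) (i∉f v)

  squeezed-coloring : {G : Graph n} → (∀ u v → adj G u v ≡ true → f u ≢ f v) →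
    (∀ l → l ≢ i → ∃ λ v → f v ≡ l) → Coloring G m
  squeezed-coloring f-proper f-covers = record
    { col      = squeeze
    ; proper   = λ u v uv → f-proper u v uv ∘ squeeze-reflects-≡
    ; nonempty = hit
    }
    where
    hit : ∀ l → ∃ λ v → squeeze v ≡ l
    hit l with f-covers (punchIn i l) (punchInᵢ≢i i l)
    ... | v , fv≡l⁺ = v , trans (punchOut-cong i fv≡l⁺) (punchOut-punchIn i)

module Recoloring {n k : ℕ} {G : Graph n} (c : Coloring G k) (x : Fin n) (j : Fin k)
                   (j-free : ∀ u → adj G x u ≡ true → col c u ≢ j) where

  recolor : Fin n → Fin k
  recolor = updateAt (col c) x (const j)

  recolor-x : recolor x ≡ j
  recolor-x = updateAt-updates x (col c)

  recolor-≢x : ∀ {v} → v ≢ x → recolor v ≡ col c v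
  recolor-≢x {v} = updateAt-minimal v x (col c)

  recolor-proper : ∀ u v → adj G u v ≡ true → recolor u ≢ recolor v
  recolor-proper u v uv with u ≟ x | v ≟ x
  ... | yes refl | yes refl = λ _ → contradiction (trans (sym uv) (irrefl G x)) λ ()
  ... | yes refl | no v≢x  = subst₂ _≢_ (sym recolor-x) (sym (recolor-≢x v≢x)) (j-free v uv ∘ sym)
  ... | no u≢x  | yes refl = subst₂ _≢_ (sym (recolor-≢x u≢x)) (sym recolor-x) (j-free u (trans (adj-sym G x u) uv))
  ... | no u≢x  | no v≢x  = subst₂ _≢_ (sym (recolor-≢x u≢x)) (sym (recolor-≢x v≢x)) (proper c u v uv)

  recolor-classes⇒classes : (σ : Automorphism G) → to σ x ≡ x →
    (∀ v → recolor (to σ v) ≡ recolor v) → ∀ v → col c (to σ v) ≡ col c v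
  recolor-classes⇒classes σ σx≡x same v with v ≟ x
  ... | yes refl = cong (col c) σx≡x
  ... | no v≢x   = subst₂ _≡_ (recolor-≢x (automorphism-fixing-≢ σ σx≡x v≢x)) (recolor-≢x v≢x) (same v)

  recolor-distinguishing : (∀ (σ : Automorphism G) → to σ x ≡ x) → IsDistinguishing c →
    (σ : Automorphism G) → (∀ v → recolor (to σ v) ≡ recolor v) → ∀ v → to σ v ≡ v
  recolor-distinguishing fixed c-dist σ = c-dist σ ∘ recolor-classes⇒classes σ (fixed σ)

  recolor-covers : ∀ l → l ≢ col c x → ∃ λ v → recolor v ≡ l
  recolor-covers l l≢cx with nonempty c l
  ... | v , cv≡l = v , trans (recolor-≢x v≢x) cv≡l
    where
    v≢x : v ≢ x
    v≢x refl = l≢cx (sym cv≡l)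

  SharedColor : Set
  SharedColor = ∃ λ w → w ≢ x × col c w ≡ col c x

  recoloring : SharedColor → Coloring G k
  recoloring (w , w≢x , cw≡cx) = record { col = recolor ; proper = recolor-proper ; nonempty = hit }
    where
    hit : ∀ l → ∃ λ v → recolor v ≡ l
    hit l with nonempty c l
    ... | v , cv≡l with v ≟ x
    ...   | no v≢x   = v , trans (recolor-≢x v≢x) cv≡l
    ...   | yes refl = w , trans (recolor-≢x w≢x) (trans cw≡cx cv≡l)

  recoloring-differs : j ≢ col c x → (shared : SharedColor) → ¬ SamePartition c (recoloring shared)
  recoloring-differs j≢cx shared same with nonempty c j
  ... | w , cw≡j = j≢cx (trans (sym cw≡j) (Equivalence.from (same w x) recolor-w≡recolor-x))
    where
    w≢x : w ≢ x
    w≢x refl = j≢cx (sym cw≡j)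
    recolor-w≡recolor-x : recolor w ≡ recolor x
    recolor-w≡recolor-x = trans (recolor-≢x w≢x) (trans cw≡j (sym recolor-x))

  recolor-misses : j ≢ col c x → ¬ SharedColor → ∀ v → col c x ≢ recolor v
  recolor-misses j≢cx alone v cx≡rv with v ≟ x
  ... | yes refl = j≢cx (sym (trans cx≡rv recolor-x))
  ... | no v≢x   = alone (v , v≢x , sym (trans cx≡rv (recolor-≢x v≢x)))

distinguishing-not-unique : ∀ {n} (G : Graph n) (x : Fin n) → (∀ (σ : Automorphism G) → to σ x ≡ x) →
  ∀ k → deg G x + 1 < k → (∀ i → i < k → ¬ DistColoring G i) →
  ((c , _) : DistColoring G k) → ¬ (∀ (d : DistColoring G k) → SamePartition c (proj₁ d))
distinguishing-not-unique G x fixed (suc m) deg+1<k minimal (c , c-dist) unique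
  with ∃-color-unused-on-closed-neighbourhood c x deg+1<k
... | j , j≢cx , j-free with any? (λ w → ¬? (w ≟ x) ×-dec (col c w ≟ col c x))
...   | yes shared =
  recoloring-differs j≢cx shared (unique (recoloring shared , recolor-distinguishing fixed c-dist))
  where open Recoloring c x j j-free
...   | no alone = minimal m (n<1+n m)
  ( squeezed-coloring recolor (col c x) misses recolor-proper recolor-covers
  , λ σ same → recolor-distinguishing fixed c-dist σ (squeeze-reflects-≡ recolor (col c x) misses ∘ same) )
  where
  open Recoloring c x j j-free
  misses : ∀ v → col c x ≢ recolor v
  misses = recolor-misses j≢cx alone

lemma4p1 : ∀ (n : ℕ) (G : Graph n) (x : Fin n)
    → (∀ (σ : Automorphism G) → to σ x ≡ x)
    → ∀ (k : ℕ) → IsChiD G k → deg G x + 1 < k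
    → ¬ UniquelyDistColorable G
lemma4p1 n G x fixed k (_ , k-minimal) deg+1<k (k′ , (c′ , k′-minimal) , c , unique) =
  distinguishing-not-unique G x fixed k′ deg+1<k′ k′-minimal c unique
  where
  deg+1<k′ : deg G x + 1 < k′
  deg+1<k′ = <-≤-trans deg+1<k (≮⇒≥ (λ k′<k → k-minimal k′ k′<k c′))
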